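{- There is no way to assign an integer $\mathrm{dinv}(\alpha)$ to every $r$-Schröder path $\alpha\in\mathrm{Sch}_{n,d}^r$ (for all integers $r\ge 1$, $n\ge 1$, $0\le d\le n$) such that, for all such $n,d,r$, both of the following hold: (i) the polynomial $S_{n,d}^r(q,t):=\sum_{\alpha\in \mathrm{Sch}_{n,d}^r} q^{\mathrm{aire}(\alpha)}t^{\mathrm{dinv}(\alpha)}$ is symmetric, i.e. $S_{n,d}^r(q,t)=S_{n,d}^r(t,q)$; (ii) there exists an integer $w$ (possibly depending on $n,d,r$) with $$q^{w}\sum_{\alpha\in \mathrm{Sch}_{n,d}^r} q^{\mathrm{aire}(\alpha)-\mathrm{dinv}(\alpha)}=\frac{1}{[dr+1]_q}\binom{n}{d}_q\binom{dr+n}{n}_q .$$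
   Context: Fix integers $r\ge1$, $n\ge1$, $0\le d\le n$. An $r$-Schröder path is a sequence of lattice steps starting at $(0,n)$ and ending at $(rn,0)$, never passing strictly above the line through $(0,n)$ and $(rn,0)$, where the allowed steps are $(0,-1)$ (down), $(1,0)$ (right) and $(r,-1)$ (diagonal). $\mathrm{Sch}_{n,d}^r$ denotes the set of such paths having exactly $n-d$ diagonal steps. Number the rows $i=1,\dots,n$ from the top, row $i$ being the horizontal strip between $y=n-i+1$ and $y=n-i$; each row is crossed by exactly one down or diagonal step of $\alpha$, and $\mathrm{aireg}_i(\alpha)$ is the $x$-coordinate of the starting point of that step (the number of full unit squares in row $i$ to the left of the path). The area of row $i$ is $\mathrm{aire}_i(\alpha)=r(i-1)-\mathrm{aireg}_i(\alpha)$, and $\mathrm{aire}(\alpha)=\sum_{i=1}^n \mathrm{aire}_i(\alpha)$. The $q$-analogues are $[m]_q=1+q+\dots+q^{m-1}$, $[m]!_q=[1]_q[2]_q\cdots[m]_q$, $\binom{m}{k}_q=\frac{[m]!_q}{[k]!_q[m-k]!_q}$. -}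

module Defs where

open import Data.Bool using (Bool; true; false; _∧_; if_then_else_)
open import Data.Nat as ℕ using (ℕ; zero; suc)
open import Data.Integer as ℤ using (ℤ; +_; _+_; _-_; _*_)
open import Data.Product using (_×_; _,_)
open import Data.List using (List; []; _∷_; map; concatMap; length; upTo)
open import Relation.Nullary using (does)
open import Relation.Binary.PropositionalEquality using (_≡_)

data Step : Set where
  down right diag : Step

Point : Set
Point = ℤ × ℤ

move : ℕ → Point → Step → Point
move r (x , y) down  = (x , y - + 1)
move r (x , y) right = (x + + 1 , y)
move r (x , y) diag  = (x + + r , y - + 1)

vertices : ℕ → Point → List Step → List Point
vertices r p []       = p ∷ []
vertices r p (s ∷ ss) = p ∷ vertices r (move r p s) ss

endpoint : ℕ → Point → List Step → Point
endpoint r p []       = p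
endpoint r p (s ∷ ss) = endpoint r (move r p s) ss

start : ℕ → Point
start n = (+ 0 , + n)

-- (x,y) is not strictly above the line through (0,n) and (rn,0),
-- i.e. x + r y ≤ r n.  (Steps are straight segments, and diagonal steps are
-- parallel to the line, so checking the visited lattice points suffices.)
notAbove : ℕ → ℕ → Point → Bool
notAbove r n (x , y) = does ((x + + r * y) ℤ.≤? (+ r * + n))

samePoint : Point → Point → Bool
samePoint (x , y) (a , b) = does (x ℤ.≟ a) ∧ does (y ℤ.≟ b)

numDiag : List Step → ℕ
numDiag []          = 0
numDiag (diag ∷ ss) = suc (numDiag ss)
numDiag (_ ∷ ss)    = numDiag ss

allᵇ : {A : Set} → (A → Bool) → List A → Bool
allᵇ p []       = true
allᵇ p (a ∷ as) = p a ∧ allᵇ p as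

isSch : ℕ → ℕ → ℕ → List Step → Bool
isSch r n d α =
  allᵇ (notAbove r n) (vertices r (start n) α)
  ∧ samePoint (endpoint r (start n) α) (+ (r ℕ.* n) , + 0)
  ∧ does (numDiag α ℕ.≟ (n ℕ.∸ d))

words : ℕ → List (List Step)
words zero    = [] ∷ []
words (suc k) = concatMap (λ w → (down ∷ w) ∷ (right ∷ w) ∷ (diag ∷ w) ∷ []) (words k)

filterᵇ : {A : Set} → (A → Bool) → List A → List A
filterᵇ p []       = []
filterᵇ p (a ∷ as) = if p a then a ∷ filterᵇ p as else filterᵇ p as

-- A path in
-- Sch^r_{n,d} has n down/diagonal steps and at most rn right steps, hence
-- length ≤ rn + n; we list all words of length 0..rn+n and keep those in Sch.
Sch : ℕ → ℕ → ℕ → List (List Step)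
Sch r n d = filterᵇ (isSch r n d) (concatMap words (upTo (suc (r ℕ.* n ℕ.+ n))))

-- Area.  Walking from (0,n), each down/diagonal step starting at (x,y)
-- crosses row i = n - y + 1 and aireg_i = x; aire_i = r(i-1) - aireg_i.

rowIndex : ℕ → ℤ → ℤ
rowIndex n y = + n - y + + 1

aireFrom : ℕ → ℕ → Point → List Step → ℤ
aireFrom r n p []                  = + 0
aireFrom r n p (right ∷ ss)        = aireFrom r n (move r p right) ss
aireFrom r n (x , y) (down ∷ ss)   =
  (+ r * (rowIndex n y - + 1) - x) + aireFrom r n (move r (x , y) down) ss
aireFrom r n (x , y) (diag ∷ ss)   =
  (+ r * (rowIndex n y - + 1) - x) + aireFrom r n (move r (x , y) diag) ss

aire : ℕ → ℕ → List Step → ℤ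
aire r n α = aireFrom r n (start n) α

-- Laurent polynomials in one variable q with coefficients in ℕ, represented
-- as the multiset (list) of exponents of their monomials:  [e₁,…,e_k] ↦ Σ q^{eᵢ}.

LPoly : Set
LPoly = List ℤ

count : {A : Set} → (A → Bool) → List A → ℕ
count p as = length (filterᵇ p as)

coeff : ℤ → LPoly → ℕ
coeff k P = count (λ e → does (e ℤ.≟ k)) P

_≐_ : LPoly → LPoly → Set
P ≐ Q = ∀ k → coeff k P ≡ coeff k Q

infix 4 _≐_

_⊗_ : LPoly → LPoly → LPoly
P ⊗ Q = concatMap (λ a → map (λ b → a + b) Q) P

infixl 7 _⊗_

shift : ℤ → LPoly → LPoly
shift w P = map (λ e → w + e) P

qint : ℕ → LPoly
qint m = map +_ (upTo m)

qfact : ℕ → LPoly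
qfact zero    = + 0 ∷ []
qfact (suc m) = qfact m ⊗ qint (suc m)

-- Laurent polynomials in two variables q,t with ℕ coefficients, as the
-- multiset of exponent pairs (a,b) of the monomials q^a t^b.

LPoly₂ : Set
LPoly₂ = List (ℤ × ℤ)

coeff₂ : ℤ → ℤ → LPoly₂ → ℕ
coeff₂ a b P = count (λ e → samePoint e (a , b)) P

Symmetric₂ : LPoly₂ → Set
Symmetric₂ P = ∀ a b → coeff₂ a b P ≡ coeff₂ b a P

-- A dinv statistic: an integer for each r-Schröder path in Sch^r_{n,d}
-- (its values on words that are not in Sch^r_{n,d} are irrelevant).

Dinv : Set
Dinv = (r n d : ℕ) → List Step → ℤ

S : Dinv → ℕ → ℕ → ℕ → LPoly₂
S dinv r n d = map (λ α → (aire r n α , dinv r n d α)) (Sch r n d)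

Sdiff : Dinv → ℕ → ℕ → ℕ → LPoly
Sdiff dinv r n d = map (λ α → aire r n α - dinv r n d α) (Sch r n d)

-- Let Σ P denote the sum of the exponents of a Laurent polynomial P with
-- natural coefficients, i.e. P′(1).  The symmetry S(q,t) = S(t,q) swaps the
-- totals of aire and dinv over Sch, so Σ (Σ_α q^{aire α − dinv α}) = 0.  Since
-- Σ (P · Q) = |Q| Σ P + |P| Σ Q, where |P| = P(1), applying Σ to both sides of
-- (ii) for r = 2, n = 2, d = 1 (four paths) gives 96 + 48 w = 168, forcing
-- w = 3/2.
module Submission where

open import Defs
open import Data.Nat using (ℕ; _≤_; _*_; _+_; _∸_)
open import Data.Integer using (ℤ)
open import Data.Product using (Σ; ∃-syntax; _×_)
open import Relation.Nullary using (¬_)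

open import Algebra.Bundles using (AbelianGroup; CommutativeMonoid)
import Algebra.Properties.Group as GroupProperties
open import Data.Bool using (Bool; true; false)
open import Data.Bool.Properties using (∧-comm)
open import Data.Integer as ℤ using (+_; 0ℤ; _-_)
import Data.Integer.Properties as ℤ
open import Data.Integer.Solver using (module +-*-Solver)
open import Data.List using (List; []; _∷_; _++_; map; length; foldr)
open import Data.List.Properties using (map-∘; length-map)
open import Data.List.Relation.Binary.Permutation.Propositional
  using (_↭_; ↭-refl; ↭-sym; ↭-trans; prep; swap; ↭⇒↭ₛ)
open import Data.List.Relation.Binary.Permutation.Propositional.Properties
  using (map⁺) renaming (shift to ↭-shift)
open import Data.List.Relation.Binary.Permutation.Setoid.Properties
  using (foldr-commMonoid)
open import Data.Nat as ℕ using (suc)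
import Data.Nat.Properties as ℕ
open import Data.Nat.Divisibility using (divides; n∣m⇒m%n≡0)
import Data.Product as ×
open import Data.Product using (_,_; proj₁; proj₂; ∃₂)
open import Function using (_∘_)
open import Relation.Binary.PropositionalEquality
open import Relation.Nullary using (does; yes; contradiction)
open import Relation.Nullary.Decidable using (dec-true)

count-↭ : {A : Set} (p : A → Bool) {xs ys : List A} → xs ↭ ys → count p xs ≡ count p ys
count-↭ p (_↭_.refl) = refl
count-↭ p (prep x xs↭ys) with p x
... | true  = cong suc (count-↭ p xs↭ys)
... | false = count-↭ p xs↭ys
count-↭ p (swap x y xs↭ys) with p x | p y
... | true  | true  = cong (suc ∘ suc) (count-↭ p xs↭ys)
... | true  | false = cong suc (count-↭ p xs↭ys)
... | false | true  = cong suc (count-↭ p xs↭ys)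
... | false | false = count-↭ p xs↭ys
count-↭ p (_↭_.trans xs↭ys ys↭zs) = trans (count-↭ p xs↭ys) (count-↭ p ys↭zs)

count-∷-cancel : {A : Set} (p : A → Bool) (x : A) (xs ys : List A) →
                 count p (x ∷ xs) ≡ count p (x ∷ ys) → count p xs ≡ count p ys
count-∷-cancel p x xs ys eq with p x
... | true  = ℕ.suc-injective eq
... | false = eq

count-map : {A B : Set} (p : B → Bool) (f : A → B) (xs : List A) →
            count p (map f xs) ≡ count (p ∘ f) xs
count-map p f []       = refl
count-map p f (x ∷ xs) with p (f x)
... | true  = cong suc (count-map p f xs)
... | false = count-map p f xs

count-cong : {A : Set} {p p′ : A → Bool} → (∀ x → p x ≡ p′ x) →
             (xs : List A) → count p xs ≡ count p′ xs
count-cong p≗p′ []       = refl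
count-cong {p = p} p≗p′ (x ∷ xs) rewrite sym (p≗p′ x) with p x
... | true  = cong suc (count-cong p≗p′ xs)
... | false = count-cong p≗p′ xs

module Multiplicity {A : Set} (_==_ : A → A → Bool)
                    (==-sound : ∀ {x y} → (x == y) ≡ true → x ≡ y)
                    (==-refl : ∀ x → (x == x) ≡ true) where

  multiplicity : A → List A → ℕ
  multiplicity k = count (_== k)

  multiplicity-head : ∀ x xs → multiplicity x (x ∷ xs) ≡ suc (multiplicity x xs)
  multiplicity-head x xs rewrite ==-refl x = refl

  split-at : ∀ k xs {m} → multiplicity k xs ≡ suc m → ∃₂ λ ys zs → xs ≡ ys ++ k ∷ zs
  split-at k (x ∷ xs) eq with x == k in x==k
  ... | true  = [] , xs , cong (_∷ xs) (==-sound x==k)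
  ... | false with ys , zs , refl ← split-at k xs eq = x ∷ ys , zs , refl

  same-multiplicities⇒↭ : ∀ xs ys → (∀ k → multiplicity k xs ≡ multiplicity k ys) → xs ↭ ys
  same-multiplicities⇒↭ []       []       _  = ↭-refl
  same-multiplicities⇒↭ []       (y ∷ ys) eq =
    contradiction (trans (eq y) (multiplicity-head y ys)) (ℕ.0≢1+n)
  same-multiplicities⇒↭ (x ∷ xs) ys       eq
    with us , vs , refl ← split-at x ys (trans (sym (eq x)) (multiplicity-head x xs)) =
    ↭-trans (prep x (same-multiplicities⇒↭ xs (us ++ vs) eq′)) (↭-sym (↭-shift x us vs))
    where
    eq′ : ∀ k → multiplicity k xs ≡ multiplicity k (us ++ vs)
    eq′ k = count-∷-cancel (_== k) x xs (us ++ vs) (trans (eq k) (count-↭ (_== k) (↭-shift x us vs)))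

_=ℤ_ : ℤ → ℤ → Bool
i =ℤ j = does (i ℤ.≟ j)

=ℤ-sound : ∀ {i j} → (i =ℤ j) ≡ true → i ≡ j
=ℤ-sound {i} {j} eq with i ℤ.≟ j
... | yes i≡j = i≡j

=ℤ-refl : ∀ i → (i =ℤ i) ≡ true
=ℤ-refl i = dec-true (i ℤ.≟ i) refl

samePoint-sound : ∀ {u v} → samePoint u v ≡ true → u ≡ v
samePoint-sound {x , y} {a , b} eq with x ℤ.≟ a | y ℤ.≟ b
... | yes x≡a | yes y≡b = cong₂ _,_ x≡a y≡b

samePoint-refl : ∀ u → samePoint u u ≡ true
samePoint-refl (x , y) rewrite =ℤ-refl x | =ℤ-refl y = refl

≐⇒↭ : ∀ (P Q : LPoly) → P ≐ Q → P ↭ Q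
≐⇒↭ = Multiplicity.same-multiplicities⇒↭ _=ℤ_ =ℤ-sound =ℤ-refl

Symmetric₂⇒↭-swap : ∀ (P : LPoly₂) → Symmetric₂ P → P ↭ map ×.swap P
Symmetric₂⇒↭-swap P sym₂ =
  Multiplicity.same-multiplicities⇒↭ samePoint samePoint-sound samePoint-refl P (map ×.swap P)
    λ { (a , b) → begin
      coeff₂ a b P                                        ≡⟨ sym₂ a b ⟩
      coeff₂ b a P                                        ≡⟨ count-cong (swapped a b) P ⟩
      count (λ e → samePoint (×.swap e) (a , b)) P        ≡⟨ count-map _ ×.swap P ⟨
      coeff₂ a b (map ×.swap P)                           ∎ }
  where
  open ≡-Reasoning
  swapped : ∀ a b (e : ℤ × ℤ) → samePoint e (b , a) ≡ samePoint (×.swap e) (a , b)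
  swapped a b (x , y) = ∧-comm (x =ℤ b) (y =ℤ a)

sum : List ℤ → ℤ
sum = foldr ℤ._+_ 0ℤ

sum-↭ : ∀ {xs ys} → xs ↭ ys → sum xs ≡ sum ys
sum-↭ p = foldr-commMonoid ℤ+.setoid ℤ+.isCommutativeMonoid (↭⇒↭ₛ p)
  where module ℤ+ = CommutativeMonoid ℤ.+-0-commutativeMonoid

sum-++ : ∀ xs ys → sum (xs ++ ys) ≡ sum xs ℤ.+ sum ys
sum-++ []       ys = sym (ℤ.+-identityˡ (sum ys))
sum-++ (x ∷ xs) ys = trans (cong (ℤ._+_ x) (sum-++ xs ys)) (sym (ℤ.+-assoc x (sum xs) (sum ys)))

sum-map-− : {A : Set} (f g : A → ℤ) (xs : List A) →
            sum (map (λ a → f a - g a) xs) ≡ sum (map f xs) - sum (map g xs)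
sum-map-− f g []       = refl
sum-map-− f g (x ∷ xs) =
  trans (cong (ℤ._+_ (f x - g x)) (sum-map-− f g xs)) (interchange (f x) (g x) _ _)
  where
  open +-*-Solver
  interchange : ∀ a b c d → a - b ℤ.+ (c - d) ≡ a ℤ.+ c - (b ℤ.+ d)
  interchange = solve 4 (λ a b c d → a :- b :+ (c :- d) := a :+ c :- (b :+ d)) refl

sum-shift : ∀ w (P : LPoly) → sum (shift w P) ≡ + length P ℤ.* w ℤ.+ sum P
sum-shift w []       = refl
sum-shift w (e ∷ P) = begin
  w ℤ.+ e ℤ.+ sum (shift w P)                  ≡⟨ cong (ℤ._+_ (w ℤ.+ e)) (sum-shift w P) ⟩
  w ℤ.+ e ℤ.+ (+ length P ℤ.* w ℤ.+ sum P)     ≡⟨ regroup (+ length P) w e (sum P) ⟩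
  (+ 1 ℤ.+ + length P) ℤ.* w ℤ.+ (e ℤ.+ sum P) ∎
  where
  open ≡-Reasoning
  open +-*-Solver
  regroup : ∀ l w e s → w ℤ.+ e ℤ.+ (l ℤ.* w ℤ.+ s) ≡ (+ 1 ℤ.+ l) ℤ.* w ℤ.+ (e ℤ.+ s)
  regroup = solve 4 (λ l w e s → w :+ e :+ (l :* w :+ s) := (con (+ 1) :+ l) :* w :+ (e :+ s)) refl

sum-⊗ : ∀ (P Q : LPoly) → sum (P ⊗ Q) ≡ + length Q ℤ.* sum P ℤ.+ + length P ℤ.* sum Q
sum-⊗ []      Q = sym (cong (ℤ._+ 0ℤ) (ℤ.*-zeroʳ (+ length Q)))
sum-⊗ (e ∷ P) Q = begin
  sum (shift e Q ++ P ⊗ Q)                                          ≡⟨ sum-++ (shift e Q) (P ⊗ Q) ⟩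
  sum (shift e Q) ℤ.+ sum (P ⊗ Q)                                   ≡⟨ cong₂ ℤ._+_ (sum-shift e Q) (sum-⊗ P Q) ⟩
  lQ ℤ.* e ℤ.+ sum Q ℤ.+ (lQ ℤ.* sum P ℤ.+ + length P ℤ.* sum Q)   ≡⟨ regroup lQ e (sum Q) (sum P) (+ length P) ⟩
  lQ ℤ.* (e ℤ.+ sum P) ℤ.+ (+ 1 ℤ.+ + length P) ℤ.* sum Q           ∎
  where
  lQ : ℤ
  lQ = + length Q
  open ≡-Reasoning
  open +-*-Solver
  regroup : ∀ lq e sq sp lp →
            lq ℤ.* e ℤ.+ sq ℤ.+ (lq ℤ.* sp ℤ.+ lp ℤ.* sq) ≡ lq ℤ.* (e ℤ.+ sp) ℤ.+ (+ 1 ℤ.+ lp) ℤ.* sq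
  regroup = solve 5 (λ lq e sq sp lp →
    lq :* e :+ sq :+ (lq :* sp :+ lp :* sq) := lq :* (e :+ sp) :+ (con (+ 1) :+ lp) :* sq) refl

sum-exponent-differences-symmetric : ∀ (P : LPoly₂) → Symmetric₂ P →
                                     sum (map (λ (a , b) → a - b) P) ≡ 0ℤ
sum-exponent-differences-symmetric P sym₂ = begin
  sum (map (λ (a , b) → a - b) P)                ≡⟨ sum-map-− proj₁ proj₂ P ⟩
  sum (map proj₁ P) - sum (map proj₂ P)          ≡⟨ cong (_- sum (map proj₂ P)) Σq≡Σt ⟩
  sum (map proj₂ P) - sum (map proj₂ P)          ≡⟨ ℤ.+-inverseʳ (sum (map proj₂ P)) ⟩
  0ℤ                                             ∎
  where
  open ≡-Reasoning
  Σq≡Σt : sum (map proj₁ P) ≡ sum (map proj₂ P)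
  Σq≡Σt = trans (sum-↭ (map⁺ proj₁ (Symmetric₂⇒↭-swap P sym₂)))
                (cong sum (sym (map-∘ {g = proj₁} {f = ×.swap} P)))

sum-Sdiff : ∀ dinv r n d → Symmetric₂ (S dinv r n d) → sum (Sdiff dinv r n d) ≡ 0ℤ
sum-Sdiff dinv r n d sym₂ =
  trans (cong sum (map-∘ (Sch r n d))) (sum-exponent-differences-symmetric (S dinv r n d) sym₂)

sum-shift-balanced : ∀ w (D : LPoly) → sum D ≡ 0ℤ → sum (shift w D) ≡ + length D ℤ.* w
sum-shift-balanced w D ΣD≡0 = begin
  sum (shift w D)                 ≡⟨ sum-shift w D ⟩
  + length D ℤ.* w ℤ.+ sum D      ≡⟨ cong (ℤ._+_ (+ length D ℤ.* w)) ΣD≡0 ⟩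
  + length D ℤ.* w ℤ.+ 0ℤ         ≡⟨ ℤ.+-identityʳ (+ length D ℤ.* w) ⟩
  + length D ℤ.* w                ∎
  where open ≡-Reasoning

sum-⊗-shift-balanced : ∀ (P R D : LPoly) w → P ⊗ shift w D ≐ R → sum D ≡ 0ℤ →
                       + length D ℤ.* sum P ℤ.+ + length P ℤ.* (+ length D ℤ.* w) ≡ sum R
sum-⊗-shift-balanced P R D w eq ΣD≡0 = begin
  + length D ℤ.* sum P ℤ.+ + length P ℤ.* (+ length D ℤ.* w)
    ≡⟨ cong₂ (λ l s → + l ℤ.* sum P ℤ.+ + length P ℤ.* s)
             (length-map (ℤ._+_ w) D) (sum-shift-balanced w D ΣD≡0) ⟨
  + length (shift w D) ℤ.* sum P ℤ.+ + length P ℤ.* sum (shift w D)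
    ≡⟨ sum-⊗ P (shift w D) ⟨
  sum (P ⊗ shift w D)
    ≡⟨ sum-↭ (≐⇒↭ (P ⊗ shift w D) R eq) ⟩
  sum R ∎
  where open ≡-Reasoning

48w≢72 : ∀ w → + 48 ℤ.* w ≢ + 72
48w≢72 w eq = contradiction (n∣m⇒m%n≡0 72 48 (divides ℤ.∣ w ∣ 72≡∣w∣*48)) λ ()
  where
  72≡∣w∣*48 : 72 ≡ ℤ.∣ w ∣ * 48
  72≡∣w∣*48 = trans (sym (cong ℤ.∣_∣ eq)) (trans (ℤ.abs-* (+ 48) w) (ℕ.*-comm 48 ℤ.∣ w ∣))

96+12*4w≢168 : ∀ w → + 96 ℤ.+ + 12 ℤ.* (+ 4 ℤ.* w) ≢ + 168
96+12*4w≢168 w eq =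
  48w≢72 w (trans (ℤ.*-assoc (+ 12) (+ 4) w)
                  (GroupProperties.∙-cancelˡ ℤ+.group (+ 96) _ _ eq))
  where module ℤ+ = AbelianGroup ℤ.+-0-abelianGroup

no-dinv-for-2-2-1 : ∀ dinv →
  ¬ (Symmetric₂ (S dinv 2 2 1)
     × ∃[ w ] (qint (1 * 2 + 1) ⊗ qfact 1 ⊗ qfact (2 ∸ 1) ⊗ qfact 2 ⊗ qfact (1 * 2)
                 ⊗ shift w (Sdiff dinv 2 2 1)
               ≐ qfact 2 ⊗ qfact (1 * 2 + 2)))
no-dinv-for-2-2-1 dinv (sym₂ , w , eq) = 96+12*4w≢168 w (begin
  + 4 ℤ.* + 24 ℤ.+ + 12 ℤ.* (+ 4 ℤ.* w)
    ≡⟨ cong (λ l → + l ℤ.* + 24 ℤ.+ + 12 ℤ.* (+ l ℤ.* w)) |D|≡4 ⟨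
  + length D ℤ.* + 24 ℤ.+ + 12 ℤ.* (+ length D ℤ.* w)
    ≡⟨ cong₂ (λ s l → + length D ℤ.* s ℤ.+ + l ℤ.* (+ length D ℤ.* w)) ΣP≡24 |P|≡12 ⟨
  + length D ℤ.* sum P ℤ.+ + length P ℤ.* (+ length D ℤ.* w)
    ≡⟨ sum-⊗-shift-balanced P R D w eq (sum-Sdiff dinv 2 2 1 sym₂) ⟩
  sum R
    ≡⟨ ΣR≡168 ⟩
  + 168 ∎)
  where
  open ≡-Reasoning
  P R D : LPoly
  P = qint (1 * 2 + 1) ⊗ qfact 1 ⊗ qfact (2 ∸ 1) ⊗ qfact 2 ⊗ qfact (1 * 2)
  R = qfact 2 ⊗ qfact (1 * 2 + 2)
  D = Sdiff dinv 2 2 1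
  |D|≡4 : length D ≡ 4
  |D|≡4 = length-map (λ α → aire 2 2 α - dinv 2 2 1 α) (Sch 2 2 1)
  |P|≡12 : length P ≡ 12
  |P|≡12 = refl
  ΣP≡24 : sum P ≡ + 24
  ΣP≡24 = refl
  ΣR≡168 : sum R ≡ + 168
  ΣR≡168 = refl

mainTheorem1 :
  ¬ (Σ Dinv λ dinv →
      (r n d : ℕ) → 1 ≤ r → 1 ≤ n → d ≤ n →
        Symmetric₂ (S dinv r n d)
        × ∃[ w ] (qint (d * r + 1) ⊗ qfact d ⊗ qfact (n ∸ d) ⊗ qfact n ⊗ qfact (d * r)
                    ⊗ shift w (Sdiff dinv r n d)
                  ≐ qfact n ⊗ qfact (d * r + n)))
mainTheorem1 (dinv , conditions) =
  no-dinv-for-2-2-1 dinv (conditions 2 2 1 (ℕ.s≤s ℕ.z≤n) (ℕ.s≤s ℕ.z≤n) (ℕ.s≤s ℕ.z≤n))
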